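{- Let $L$ be a complete lattice with a unary operation $-$ that is anti-monotone and such that $L$ has down-distribution, let $F$ be a set of designated values in $L$, and let implication be $x\supset y=-x+y$. If $F$ is implicative, then for every $L$-model $M=\langle W,R,v\rangle$, every $w\in W$ and all formulas $\varphi,\psi$, we have $w\Vdash_{L,F}\Box(\varphi\to\psi)\to(\Box\varphi\to\Box\psi)$.
   Context: $+$ and $.$ are join and meet; $\bigwedge S$ is the greatest lower bound of $S$. $-$ is anti-monotone if $a\le b$ implies $-b\le -a$. For $A,B\subseteq L$, $A+B=\{a+b\mid a\in A,b\in B\}$; $L$ has down-distribution if $\bigwedge(A+B)=\bigwedge A+\bigwedge B$ for all $A,B\subseteq L$. A set of designated values is an upward closed subset $F\subseteq L$; $F$ is implicative if $a\le b$ implies $a\supset b\in F$. Formulas use $\land,\lor,\lnot,\to,\Box$. A normal modal valuation on a frame $\langle W,R\rangle$ is $v:W\times\mathrm{Form}\to L$ (write $v_w$) with $v_w(\varphi\lor\psi)=v_w(\varphi)+v_w(\psi)$, $v_w(\varphi\land\psi)=v_w(\varphi).v_w(\psi)$, $v_w(\lnot\varphi)=-v_w(\varphi)$, $v_w(\varphi\to\psi)=-v_w(\varphi)+v_w(\psi)$, $v_w(\Box\varphi)=\bigwedge\{v_{w'}(\varphi)\mid wRw'\}$. An $L$-model is $\langle W,R,v\rangle$ with such $v$; $w\Vdash_{L,F}\varphi$ iff $v_w(\varphi)\in F$. -}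

module Defs where

open import Level using (0ℓ)
open import Data.Nat using (ℕ)
open import Data.Product using (Σ; _×_; ∃; ∃₂)
open import Relation.Unary using (Pred; _∈_)
open import Relation.Binary.Lattice.Bundles using (Lattice)

-- A complete lattice: a lattice (join _∨_ = "+", meet _∧_ = ".")
-- together with a greatest lower bound ⋀ S for every subset S ⊆ L
-- (subsets are predicates on the carrier).
record CompleteLattice : Set₁ where
  field
    lattice : Lattice 0ℓ 0ℓ 0ℓ
  open Lattice lattice public
  field
    ⋀        : Pred Carrier 0ℓ → Carrier
    ⋀-lower  : ∀ (S : Pred Carrier 0ℓ) {x} → x ∈ S → ⋀ S ≤ x
    ⋀-greatest : ∀ (S : Pred Carrier 0ℓ) {y} → (∀ {x} → x ∈ S → y ≤ x) → y ≤ ⋀ S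

module _ (L : CompleteLattice) where
  open CompleteLattice L

  AntiMonotone : (Carrier → Carrier) → Set
  AntiMonotone neg = ∀ {a b} → a ≤ b → neg b ≤ neg a

  _⊕_ : Pred Carrier 0ℓ → Pred Carrier 0ℓ → Pred Carrier 0ℓ
  (A ⊕ B) x = ∃₂ λ a b → a ∈ A × b ∈ B × x ≈ (a ∨ b)

  DownDistribution : Set₁
  DownDistribution = ∀ (A B : Pred Carrier 0ℓ) → ⋀ (A ⊕ B) ≈ (⋀ A ∨ ⋀ B)

  -- set of designated values: an upward closed subset of L
  UpwardClosed : Pred Carrier 0ℓ → Set
  UpwardClosed F = ∀ {a b} → a ∈ F → a ≤ b → b ∈ F

  impl : (Carrier → Carrier) → Carrier → Carrier → Carrier
  impl neg a b = neg a ∨ b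

  Implicative : (Carrier → Carrier) → Pred Carrier 0ℓ → Set
  Implicative neg F = ∀ {a b} → a ≤ b → impl neg a b ∈ F

infixr 5 _⇒_
infixr 6 _∨ᶠ_
infixr 7 _∧ᶠ_
data Form : Set where
  var  : ℕ → Form
  _∧ᶠ_ : Form → Form → Form
  _∨ᶠ_ : Form → Form → Form
  ¬ᶠ_  : Form → Form
  _⇒_  : Form → Form → Form
  □_   : Form → Form

record Frame : Set₁ where
  field
    W : Set
    R : W → W → Set

module _ (L : CompleteLattice) (neg : CompleteLattice.Carrier L → CompleteLattice.Carrier L) where
  open CompleteLattice L

  record NormalValuation (fr : Frame) : Set₁ where
    open Frame fr
    field
      v     : W → Form → Carrier
      v-∨   : ∀ w φ ψ → v w (φ ∨ᶠ ψ) ≈ (v w φ ∨ v w ψ)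
      v-∧   : ∀ w φ ψ → v w (φ ∧ᶠ ψ) ≈ (v w φ ∧ v w ψ)
      v-¬   : ∀ w φ → v w (¬ᶠ φ) ≈ neg (v w φ)
      v-⇒   : ∀ w φ ψ → v w (φ ⇒ ψ) ≈ (neg (v w φ) ∨ v w ψ)
      v-□   : ∀ w φ → v w (□ φ) ≈ ⋀ (λ x → ∃ λ w′ → R w w′ × x ≈ v w′ φ)

  record Model : Set₁ where
    field
      frame : Frame
      val   : NormalValuation frame
    open Frame frame public
    open NormalValuation val public

  _,_⊩⟨_⟩_ : (M : Model) → Model.W M → Pred Carrier 0ℓ → Form → Set
  M , w ⊩⟨ F ⟩ φ = Model.v M w φ ∈ F

{-# OPTIONS --safe #-}
-- Write a = v(□(φ ⇒ ψ)), b = v(□φ), c = v(□ψ). Every element -b + v_{w′}ψ of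
-- {-b} + {v_{w′}ψ | wRw′} lies above v_{w′}(φ ⇒ ψ) ≥ a, because b ≤ v_{w′}φ and
-- - is anti-monotone. Hence a ≤ ⋀({-b} + {v_{w′}ψ}) = -b + c by down-distribution,
-- i.e. a ≤ v(□φ ⇒ □ψ), and implicativity puts a ⊃ v(□φ ⇒ □ψ) into F.
module Submission where

open import Defs
open import Relation.Unary using (Pred; _∈_)
open import Level using (0ℓ)
open import Data.Product using (_,_; _×_; ∃)
import Relation.Binary.Lattice.Properties.JoinSemilattice as JoinSemilatticeProperties
import Relation.Binary.Reasoning.PartialOrder as PosetReasoning

module CompleteLatticeProperties (L : CompleteLattice) where
  open CompleteLattice L

  ｛_｝ : Carrier → Pred Carrier 0ℓ
  ｛ x ｝ y = y ≈ x

  ⋀-singleton : ∀ x → ⋀ ｛ x ｝ ≈ x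
  ⋀-singleton x =
    antisym (⋀-lower ｛ x ｝ Eq.refl) (⋀-greatest ｛ x ｝ (λ y≈x → reflexive (Eq.sym y≈x)))

  ⋀-⊕-singleton : DownDistribution L → ∀ x S → ⋀ (_⊕_ L ｛ x ｝ S) ≈ (x ∨ ⋀ S)
  ⋀-⊕-singleton dd x S = Eq.trans (dd ｛ x ｝ S) (∨-cong (⋀-singleton x) Eq.refl)
    where open JoinSemilatticeProperties joinSemilattice using (∨-cong)

  upwardClosed-resp-≈ : ∀ {F} → UpwardClosed L F → ∀ {x y} → x ≈ y → x ∈ F → y ∈ F
  upwardClosed-resp-≈ up x≈y x∈F = up x∈F (reflexive x≈y)

module ModelProperties (L : CompleteLattice)
                       (neg : CompleteLattice.Carrier L → CompleteLattice.Carrier L)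
                       (M : Model L neg) where
  open CompleteLattice L
  open CompleteLatticeProperties L
  open JoinSemilatticeProperties joinSemilattice using (∨-monotonic; ∨-cong)
  open PosetReasoning poset
  open Model M

  successorValues : W → Form → Pred Carrier 0ℓ
  successorValues w φ x = ∃ λ w′ → R w w′ × x ≈ v w′ φ

  □-≤-successor : ∀ {w w′} φ → R w w′ → v w (□ φ) ≤ v w′ φ
  □-≤-successor {w} {w′} φ wRw′ = begin
    v w (□ φ)                 ≈⟨ v-□ w φ ⟩
    ⋀ (successorValues w φ)   ≤⟨ ⋀-lower (successorValues w φ) (w′ , wRw′ , Eq.refl) ⟩
    v w′ φ                    ∎

  □-⇒-≤-successor : AntiMonotone L neg → ∀ {w w′} φ ψ → R w w′ →
                    v w (□ (φ ⇒ ψ)) ≤ (neg (v w (□ φ)) ∨ v w′ ψ)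
  □-⇒-≤-successor anti {w} {w′} φ ψ wRw′ = begin
    v w (□ (φ ⇒ ψ))           ≤⟨ □-≤-successor (φ ⇒ ψ) wRw′ ⟩
    v w′ (φ ⇒ ψ)              ≈⟨ v-⇒ w′ φ ψ ⟩
    neg (v w′ φ) ∨ v w′ ψ     ≤⟨ ∨-monotonic (anti (□-≤-successor φ wRw′)) refl ⟩
    neg (v w (□ φ)) ∨ v w′ ψ  ∎

  □-distrib-⇒ : AntiMonotone L neg → DownDistribution L → ∀ w φ ψ →
                v w (□ (φ ⇒ ψ)) ≤ v w (□ φ ⇒ □ ψ)
  □-distrib-⇒ anti dd w φ ψ = begin
    v w (□ (φ ⇒ ψ))                                      ≤⟨ ⋀-greatest _ below-each ⟩
    ⋀ (_⊕_ L ｛ neg (v w (□ φ)) ｝ (successorValues w ψ)) ≈⟨ ⋀-⊕-singleton dd _ _ ⟩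
    neg (v w (□ φ)) ∨ ⋀ (successorValues w ψ)            ≈⟨ ∨-cong Eq.refl (Eq.sym (v-□ w ψ)) ⟩
    neg (v w (□ φ)) ∨ v w (□ ψ)                          ≈⟨ Eq.sym (v-⇒ w (□ φ) (□ ψ)) ⟩
    v w (□ φ ⇒ □ ψ)                                      ∎
    where
    below-each : ∀ {x} → x ∈ _⊕_ L ｛ neg (v w (□ φ)) ｝ (successorValues w ψ) →
                 v w (□ (φ ⇒ ψ)) ≤ x
    below-each {x} (n , y , n≈ , (w′ , wRw′ , y≈) , x≈) = begin
      v w (□ (φ ⇒ ψ))           ≤⟨ □-⇒-≤-successor anti φ ψ wRw′ ⟩
      neg (v w (□ φ)) ∨ v w′ ψ  ≈⟨ ∨-cong (Eq.sym n≈) (Eq.sym y≈) ⟩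
      n ∨ y                     ≈⟨ Eq.sym x≈ ⟩
      x                         ∎

  ⊩-⇒-from-≤ : ∀ {F} → UpwardClosed L F → Implicative L neg F →
                 ∀ w φ ψ → v w φ ≤ v w ψ → _,_⊩⟨_⟩_ L neg M w F (φ ⇒ ψ)
  ⊩-⇒-from-≤ up imp w φ ψ φ≤ψ = upwardClosed-resp-≈ up (Eq.sym (v-⇒ w φ ψ)) (imp φ≤ψ)

mainTheorem9 : (L : CompleteLattice)
    → (neg : CompleteLattice.Carrier L → CompleteLattice.Carrier L)
    → AntiMonotone L neg
    → DownDistribution L
    → (F : Pred (CompleteLattice.Carrier L) 0ℓ)
    → UpwardClosed L F
    → Implicative L neg F
    → (M : Model L neg) (w : Model.W M) (φ ψ : Form)
    → _,_⊩⟨_⟩_ L neg M w F ((□ (φ ⇒ ψ)) ⇒ ((□ φ) ⇒ (□ ψ)))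
mainTheorem9 L neg anti dd F up imp M w φ ψ =
  ⊩-⇒-from-≤ up imp w (□ (φ ⇒ ψ)) (□ φ ⇒ □ ψ) (□-distrib-⇒ anti dd w φ ψ)
  where open ModelProperties L neg M
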